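{- Let $T$ be a line trigraph that contains no odd prism, and let $H$ be a bipartite graph such that the line graph $L(H)$ is the full realization of $T$. Then $H$ has no (not necessarily induced) subgraph isomorphic to an even theta, and $H$ is series-parallel.
   Context: A trigraph $T$ consists of a finite set $V(T)$ and a map $\theta:\binom{V(T)}{2}\to\{ -1,0,1\}$; distinct $u,v$ are strongly adjacent if $\theta(uv)=1$, adjacent if $\theta(uv)\in\{0,1\}$, antiadjacent if $\theta(uv)\in\{0,-1\}$. The full realization of $T$ is the graph on $V(T)$ whose edges are the adjacent pairs. A clique (strong clique) is a set of pairwise adjacent (strongly adjacent) vertices. $T$ is a line trigraph if its full realization is the line graph of a bipartite graph and every clique of size at least $3$ is a strong clique. A prism in $T$ is an induced subtrigraph whose full realization is a prism: two disjoint triangles $\{a_1,a_2,a_3\},\{b_1,b_2,b_3\}$ and three vertex-disjoint induced paths (rungs) $P_i$ from $a_i$ to $b_i$, with no edges other than those of the triangles and rungs; it is odd if all rungs have an odd number of edges. An even theta is a graph composed of three internally disjoint paths of even length with the same two endpoints. A graph is series-parallel if it has no $K_4$ minor. -}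

module Defs where

open import Data.Nat using (ℕ; zero; suc; _≤_)
open import Data.Nat.Divisibility using (_∣_)
open import Data.Fin using (Fin; toℕ; fromℕ)
open import Data.Fin.Subset using (Subset; _∈_; ∣_∣)
open import Data.Bool using (Bool)
open import Data.Maybe using (Maybe; just)
open import Data.Product using (Σ; ∃; _×_; _,_; proj₁; proj₂)
open import Data.Sum using (_⊎_)
open import Relation.Nullary using (¬_)
open import Relation.Binary.PropositionalEquality using (_≡_; _≢_)

_⟺_ : Set → Set → Set
A ⟺ B = (A → B) × (B → A)

record Graph (n : ℕ) : Set₁ where
  field
    Adj    : Fin n → Fin n → Set
    symm   : ∀ {u v} → Adj u v → Adj v u
    irrefl : ∀ {u} → ¬ Adj u u
open Graph public

Bipartite : ∀ {m} → Graph m → Set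
Bipartite {m} H = Σ (Fin m → Bool) λ c → ∀ u v → Adj H u v → c u ≢ c v

-- Edges of H represented as ordered pairs of endpoints.
SameEdge : ∀ {m} → Fin m × Fin m → Fin m × Fin m → Set
SameEdge (a , b) (c , d) = ((a ≡ c) × (b ≡ d)) ⊎ ((a ≡ d) × (b ≡ c))

ShareEnd : ∀ {m} → Fin m × Fin m → Fin m × Fin m → Set
ShareEnd (a , b) (c , d) = (a ≡ c) ⊎ (a ≡ d) ⊎ (b ≡ c) ⊎ (b ≡ d)

-- G is isomorphic to the line graph L(H): e is a bijection from V(G) to E(H)
-- such that distinct vertices are adjacent iff the edges share an endpoint.
IsLineGraphOf : ∀ {k m} → Graph k → Graph m → Set
IsLineGraphOf {k} {m} G H =
  Σ (Fin k → Fin m × Fin m) λ e →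
    (∀ i → Adj H (proj₁ (e i)) (proj₂ (e i)))
  × (∀ u v → Adj H u v → ∃ λ i → SameEdge (e i) (u , v))
  × (∀ i j → SameEdge (e i) (e j) → i ≡ j)
  × (∀ i j → i ≢ j → (Adj G i j ⟺ ShareEnd (e i) (e j)))

data Tri : Set where
  minus zer plus : Tri

record Trigraph (n : ℕ) : Set where
  field
    θ     : Fin n → Fin n → Tri   -- only values on distinct pairs matter
    θsymm : ∀ u v → θ u v ≡ θ v u
open Trigraph public

Adjacent : ∀ {n} → Trigraph n → Fin n → Fin n → Set
Adjacent T u v = (u ≢ v) × (θ T u v ≢ minus)

StronglyAdjacent : ∀ {n} → Trigraph n → Fin n → Fin n → Set
StronglyAdjacent T u v = (u ≢ v) × (θ T u v ≡ plus)

FullRealization : ∀ {n} → Trigraph n → Graph n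
FullRealization T = record
  { Adj    = Adjacent T
  ; symm   = λ { {u} {v} (u≢v , p) →
               (λ e → u≢v (Relation.Binary.PropositionalEquality.sym e))
             , (λ q → p (Relation.Binary.PropositionalEquality.trans (θsymm T u v) q)) }
  ; irrefl = λ { (u≢u , _) → u≢u Relation.Binary.PropositionalEquality.refl }
  }

IsClique : ∀ {n} → Trigraph n → Subset n → Set
IsClique T S = ∀ u v → u ∈ S → v ∈ S → u ≢ v → Adjacent T u v

IsStrongClique : ∀ {n} → Trigraph n → Subset n → Set
IsStrongClique T S = ∀ u v → u ∈ S → v ∈ S → u ≢ v → StronglyAdjacent T u v

IsLineTrigraph : ∀ {n} → Trigraph n → Set₁
IsLineTrigraph {n} T =
  (Σ ℕ λ m → Σ (Graph m) λ H → Bipartite H × IsLineGraphOf (FullRealization T) H)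
  × (∀ (S : Subset n) → 3 ≤ ∣ S ∣ → IsClique T S → IsStrongClique T S)

-- A prism is given by three rungs indexed by r : Fin 3; rung r has
-- len r edges and vertices rung r 0 = a_r, ..., rung r (len r) = b_r.
-- All these vertices are distinct, and the induced subgraph of the full
-- realization on them has exactly the triangle edges and the rung edges.

PrismEdge : (len : Fin 3 → ℕ) (r : Fin 3) → Fin (suc (len r)) →
            (s : Fin 3) → Fin (suc (len s)) → Set
PrismEdge len r x s y =
    ((r ≢ s) × (((toℕ x ≡ 0) × (toℕ y ≡ 0)) ⊎ ((toℕ x ≡ len r) × (toℕ y ≡ len s))))
  ⊎ ((r ≡ s) × ((toℕ x ≡ suc (toℕ y)) ⊎ (toℕ y ≡ suc (toℕ x))))

IsPrism : ∀ {n} → Graph n → (len : Fin 3 → ℕ) →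
          ((r : Fin 3) → Fin (suc (len r)) → Fin n) → Set
IsPrism G len rung =
    (∀ r x s y → rung r x ≡ rung s y → (r ≡ s) × (toℕ x ≡ toℕ y))
  × (∀ r x s y → (Adj G (rung r x) (rung s y) ⟺ PrismEdge len r x s y))

Odd : ℕ → Set
Odd k = ¬ (2 ∣ k)

Even : ℕ → Set
Even k = 2 ∣ k

HasOddPrism : ∀ {n} → Trigraph n → Set
HasOddPrism {n} T =
  Σ (Fin 3 → ℕ) λ len →
  Σ ((r : Fin 3) → Fin (suc (len r)) → Fin n) λ rung →
    IsPrism (FullRealization T) len rung × (∀ r → Odd (len r))

HasEvenThetaSubgraph : ∀ {m} → Graph m → Set
HasEvenThetaSubgraph {m} H =
  Σ (Fin m) λ x → Σ (Fin m) λ y →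
  Σ (Fin 3 → ℕ) λ len →
  Σ ((r : Fin 3) → Fin (suc (len r)) → Fin m) λ p →
      (x ≢ y)
    × (∀ r → p r Data.Fin.zero ≡ x)
    × (∀ r → p r (fromℕ (len r)) ≡ y)
    × (∀ r (i : Fin (len r)) →
         Adj H (p r (Data.Fin.inject₁ i)) (p r (Data.Fin.suc i)))
    × (∀ r i s j → p r i ≡ p s j →
         ((r ≡ s) × (toℕ i ≡ toℕ j))
         ⊎ ((toℕ i ≡ 0) × (toℕ j ≡ 0))
         ⊎ ((toℕ i ≡ len r) × (toℕ j ≡ len s)))
    × (∀ r → Even (len r))

data Connected {m} (H : Graph m) (P : Fin m → Set) : Fin m → Fin m → Set where
  here : ∀ {u} → P u → Connected H P u u
  step : ∀ {u v w} → P u → Adj H u v → Connected H P v w → Connected H P u w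

-- minor model of K4: branch sets β⁻¹(just i), i : Fin 4, pairwise disjoint
-- (automatic), nonempty, connected, and pairwise joined by an edge.
HasK4Minor : ∀ {m} → Graph m → Set
HasK4Minor {m} H =
  Σ (Fin m → Maybe (Fin 4)) λ β →
      (∀ i → ∃ λ v → β v ≡ just i)
    × (∀ i u v → β u ≡ just i → β v ≡ just i → Connected H (λ w → β w ≡ just i) u v)
    × (∀ i j → i ≢ j → ∃ λ u → ∃ λ v → (β u ≡ just i) × (β v ≡ just j) × Adj H u v)

SeriesParallel : ∀ {m} → Graph m → Set
SeriesParallel H = ¬ HasK4Minor H

module Submission where

-- A bipartite graph H with three internally disjoint x–y paths of even length yields an odd
-- prism in L(H): the edges of each path form a rung with an odd number of edges, and the first
-- (last) edges of the three paths are pairwise adjacent at x (at y) and form the triangles.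
-- A K4 minor yields such a theta. Inside three branch sets take a tripod whose legs reach the
-- edges towards the other branch sets. Two of the three centres have the same colour; they are
-- joined by the direct edge between their branch sets and by detours through each of the two
-- remaining branch sets, and these three paths have even length because their ends have the
-- same colour.

open import Defs
open import Data.Bool using (Bool; true; false; not)
open import Data.Bool.Properties using (not-¬; not-involutive)
open import Data.Empty using (⊥-elim)
open import Data.Fin using (Fin; toℕ; fromℕ; fromℕ<; inject₁)
open import Data.Fin.Patterns using (0F; 1F; 2F; 3F)
open import Data.Fin.Properties using (toℕ<n; toℕ-injective; toℕ-fromℕ<; toℕ-fromℕ; toℕ-inject₁) renaming (_≟_ to _≟ᶠ_)
open import Data.List using (List; []; _∷_; _++_; reverse; length)
open import Data.List.Properties using (unfold-reverse; ++-assoc)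
open import Data.List.Membership.Propositional using (_∈_)
open import Data.List.Membership.Propositional.Properties using (∈-++⁺ˡ; ∈-++⁺ʳ; ∈-++⁻)
open import Data.List.Relation.Binary.Disjoint.Propositional using (Disjoint)
open import Data.List.Relation.Unary.All as All using ()
open import Data.List.Relation.Unary.All.Properties using (¬Any⇒All¬; ++⁻ˡ)
open import Data.List.Relation.Unary.Any using (here; there)
open import Data.List.Relation.Unary.Any.Properties using (reverse⁻)
open import Data.List.Relation.Unary.Unique.Propositional using (Unique; []; _∷_)
open import Data.List.Relation.Unary.Unique.Propositional.Properties using (++⁺)
open import Data.Maybe using (Maybe; just)
open import Data.Maybe.Properties using (just-injective)
open import Data.Nat using (ℕ; zero; suc; _≤_; _<_; pred; z≤n; s≤s; ≢-nonZero)
open import Data.Nat.DivMod using (_mod_; m≤n⇒m%n≡m)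
open import Data.Nat.Divisibility using (_∣_; _∣0; ∣-refl; ∣1⇒≡1; ∣m+n∣m⇒∣n; ∣m∣n⇒∣m+n)
open import Data.Nat.GeneralisedArithmetic using (iterate)
open import Data.Nat.Properties using (suc-injective; <⇒≤; <⇒≢; m<n⇒m<1+n; n<1+n; 1+n≢n; suc-pred; ≤-pred; ≤-refl; +-comm)
open import Data.Product using (∃; ∃₂; _×_; _,_; proj₁; proj₂)
open import Data.Sum using (_⊎_; inj₁; inj₂)
open import Function using (_∘_)
open import Relation.Nullary using (¬_; yes; no)
open import Relation.Unary using (Pred; _⊆_; _⊥_; ∅)
open import Relation.Binary.PropositionalEquality using (_≡_; _≢_; refl; sym; trans; cong; subst; subst₂)

private variable
  m : ℕ
  p p′ q q′ r : Fin m × Fin m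

SameEdge-sym : SameEdge p q → SameEdge q p
SameEdge-sym (inj₁ (refl , refl)) = inj₁ (refl , refl)
SameEdge-sym (inj₂ (refl , refl)) = inj₂ (refl , refl)

SameEdge-trans : SameEdge p q → SameEdge q r → SameEdge p r
SameEdge-trans (inj₁ (refl , refl)) q≈r = q≈r
SameEdge-trans (inj₂ (refl , refl)) (inj₁ (refl , refl)) = inj₂ (refl , refl)
SameEdge-trans (inj₂ (refl , refl)) (inj₂ (refl , refl)) = inj₁ (refl , refl)

ShareEnd-sym : ShareEnd p q → ShareEnd q p
ShareEnd-sym (inj₁ e) = inj₁ (sym e)
ShareEnd-sym (inj₂ (inj₁ e)) = inj₂ (inj₂ (inj₁ (sym e)))
ShareEnd-sym (inj₂ (inj₂ (inj₁ e))) = inj₂ (inj₁ (sym e))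
ShareEnd-sym (inj₂ (inj₂ (inj₂ e))) = inj₂ (inj₂ (inj₂ (sym e)))

ShareEnd-respʳ : SameEdge q r → ShareEnd p q → ShareEnd p r
ShareEnd-respʳ (inj₁ (refl , refl)) s = s
ShareEnd-respʳ (inj₂ (refl , refl)) (inj₁ e) = inj₂ (inj₁ e)
ShareEnd-respʳ (inj₂ (refl , refl)) (inj₂ (inj₁ e)) = inj₁ e
ShareEnd-respʳ (inj₂ (refl , refl)) (inj₂ (inj₂ (inj₁ e))) = inj₂ (inj₂ (inj₂ e))
ShareEnd-respʳ (inj₂ (refl , refl)) (inj₂ (inj₂ (inj₂ e))) = inj₂ (inj₂ (inj₁ e))

ShareEnd-resp : SameEdge p p′ → SameEdge q q′ → ShareEnd p q → ShareEnd p′ q′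
ShareEnd-resp p≈p′ q≈q′ s = ShareEnd-respʳ q≈q′ (ShareEnd-sym (ShareEnd-respʳ p≈p′ (ShareEnd-sym s)))

2∤1 : ¬ 2 ∣ 1
2∤1 2∣1 with () ← ∣1⇒≡1 2∣1

even-suc⇒odd : ∀ k → Even (suc k) → Odd k
even-suc⇒odd k 2∣1+k 2∣k = 2∤1 (∣m+n∣m⇒∣n (subst (2 ∣_) (+-comm 1 k) 2∣1+k) 2∣k)

iterate-not-even : ∀ b k → iterate not b k ≡ b → Even k
iterate-not-even b zero _ = 2 ∣0
iterate-not-even b (suc zero) eq = ⊥-elim (not-¬ refl (sym eq))
iterate-not-even b (suc (suc k)) eq =
  ∣m∣n⇒∣m+n ∣-refl (iterate-not-even b k (subst (λ b′ → iterate not b′ k ≡ b) (not-involutive b) eq))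

record EvenTheta {m} (H : Graph m) : Set where
  field
    x y        : Fin m
    len        : Fin 3 → ℕ
    path       : Fin 3 → ℕ → Fin m
    x≢y        : x ≢ y
    path-start : ∀ r → path r 0 ≡ x
    path-end   : ∀ r → path r (len r) ≡ y
    path-adj   : ∀ r k → k < len r → Adj H (path r k) (path r (suc k))
    path-meet  : ∀ r i s j → i ≤ len r → j ≤ len s → path r i ≡ path s j →
                 ((r ≡ s) × (i ≡ j)) ⊎ ((i ≡ 0) × (j ≡ 0)) ⊎ ((i ≡ len r) × (j ≡ len s))
    len-even   : ∀ r → Even (len r)

module OddPrismOfEvenTheta {n m} {T : Trigraph n} {H : Graph m}
  (L : IsLineGraphOf (FullRealization T) H) (Θ : EvenTheta H) where
  open EvenTheta Θ

  edgeOf : Fin n → Fin m × Fin m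
  edgeOf = proj₁ L

  edgeOf-surjective : ∀ u v → Adj H u v → ∃ λ i → SameEdge (edgeOf i) (u , v)
  edgeOf-surjective = proj₁ (proj₂ (proj₂ L))

  adjacent⇔shareEnd : ∀ i j → i ≢ j → (Adj (FullRealization T) i j ⟺ ShareEnd (edgeOf i) (edgeOf j))
  adjacent⇔shareEnd = proj₂ (proj₂ (proj₂ (proj₂ L)))

  edge : Fin 3 → ℕ → Fin m × Fin m
  edge r a = path r a , path r (suc a)

  rungLen : Fin 3 → ℕ
  rungLen r = pred (len r)

  len≢0 : ∀ r → len r ≢ 0
  len≢0 r len≡0 = x≢y (trans (sym (path-start r)) (trans (cong (path r) (sym len≡0)) (path-end r)))

  len≢1 : ∀ r → len r ≢ 1
  len≢1 r len≡1 = 2∤1 (subst (2 ∣_) len≡1 (len-even r))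

  len≡1+rungLen : ∀ r → len r ≡ suc (rungLen r)
  len≡1+rungLen r = sym (suc-pred (len r) {{≢-nonZero (len≢0 r)}})

  rungLen-odd : ∀ r → Odd (rungLen r)
  rungLen-odd r = even-suc⇒odd (rungLen r) (subst Even (len≡1+rungLen r) (len-even r))

  path-end′ : ∀ r → path r (suc (rungLen r)) ≡ y
  path-end′ r = trans (cong (path r) (sym (len≡1+rungLen r))) (path-end r)

  edge-injective : ∀ {r s a b} → a < len r → b < len s →
                   SameEdge (edge r a) (edge s b) → (r ≡ s) × (a ≡ b)
  edge-injective {r} {s} {a} {b} a<len b<len (inj₁ (p , q))
    with path-meet r a s b (<⇒≤ a<len) (<⇒≤ b<len) p
  ... | inj₁ r≡s×a≡b = r≡s×a≡b
  ... | inj₂ (inj₂ (a≡len , _)) = ⊥-elim (<⇒≢ a<len a≡len)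
  ... | inj₂ (inj₁ (refl , refl)) with path-meet r 1 s 1 a<len b<len q
  ...   | inj₁ (r≡s , _) = r≡s , refl
  ...   | inj₂ (inj₂ (1≡len , _)) = ⊥-elim (len≢1 r (sym 1≡len))
  edge-injective {r} {s} {a} {b} a<len b<len (inj₂ (p , q))
    with path-meet r a s (suc b) (<⇒≤ a<len) b<len p
  ... | inj₂ (inj₁ (_ , ()))
  ... | inj₂ (inj₂ (a≡len , _)) = ⊥-elim (<⇒≢ a<len a≡len)
  ... | inj₁ (refl , refl) with path-meet r (suc (suc b)) r b a<len (<⇒≤ b<len) q
  ...   | inj₁ (_ , 2+b≡b) = ⊥-elim (<⇒≢ (m<n⇒m<1+n (n<1+n b)) (sym 2+b≡b))
  ...   | inj₂ (inj₂ (_ , b≡len)) = ⊥-elim (<⇒≢ b<len b≡len)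

  RungEdge : Fin 3 → ℕ → Fin 3 → ℕ → Set
  RungEdge r a s b =
      ((r ≢ s) × (((a ≡ 0) × (b ≡ 0)) ⊎ ((a ≡ rungLen r) × (b ≡ rungLen s))))
    ⊎ ((r ≡ s) × ((a ≡ suc b) ⊎ (b ≡ suc a)))

  data EndOf (a : ℕ) : ℕ → Set where
    first  : EndOf a a
    second : EndOf a (suc a)

  EndOf-≤ : ∀ {r a i} → a < len r → EndOf a i → i ≤ len r
  EndOf-≤ a<len first = <⇒≤ a<len
  EndOf-≤ a<len second = a<len

  consecutive : ∀ {a b i} → a ≢ b → EndOf a i → EndOf b i → (a ≡ suc b) ⊎ (b ≡ suc a)
  consecutive a≢b first first = ⊥-elim (a≢b refl)
  consecutive a≢b first second = inj₁ refl
  consecutive a≢b second first = inj₂ refl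
  consecutive a≢b second second = ⊥-elim (a≢b refl)

  EndOf-start : ∀ {a} → EndOf a 0 → a ≡ 0
  EndOf-start first = refl

  EndOf-end : ∀ {r a i} → a < len r → EndOf a i → i ≡ len r → a ≡ rungLen r
  EndOf-end a<len first a≡len = ⊥-elim (<⇒≢ a<len a≡len)
  EndOf-end {r} a<len second 1+a≡len = suc-injective (trans 1+a≡len (len≡1+rungLen r))

  meet⇒rungEdge : ∀ {r s a b i j} → a < len r → b < len s → ¬ ((r ≡ s) × (a ≡ b)) →
                  EndOf a i → EndOf b j → path r i ≡ path s j → RungEdge r a s b
  meet⇒rungEdge {r} {s} {a} {b} {i} {j} a<len b<len distinct endA endB eq
    with path-meet r i s j (EndOf-≤ a<len endA) (EndOf-≤ b<len endB) eq
  ... | inj₁ (refl , refl) = inj₂ (refl , consecutive (λ a≡b → distinct (refl , a≡b)) endA endB)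
  ... | inj₂ (inj₁ (refl , refl)) with refl ← EndOf-start endA | refl ← EndOf-start endB =
    inj₁ ((λ r≡s → distinct (r≡s , refl)) , inj₁ (refl , refl))
  ... | inj₂ (inj₂ (i≡len , j≡len)) with refl ← EndOf-end a<len endA i≡len | refl ← EndOf-end b<len endB j≡len =
    inj₁ ((λ { refl → distinct (refl , refl) }) , inj₂ (refl , refl))

  shareEnd⇒rungEdge : ∀ {r s a b} → a < len r → b < len s → ¬ ((r ≡ s) × (a ≡ b)) →
                      ShareEnd (edge r a) (edge s b) → RungEdge r a s b
  shareEnd⇒rungEdge a<len b<len distinct (inj₁ eq) = meet⇒rungEdge a<len b<len distinct first first eq
  shareEnd⇒rungEdge a<len b<len distinct (inj₂ (inj₁ eq)) = meet⇒rungEdge a<len b<len distinct first second eq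
  shareEnd⇒rungEdge a<len b<len distinct (inj₂ (inj₂ (inj₁ eq))) = meet⇒rungEdge a<len b<len distinct second first eq
  shareEnd⇒rungEdge a<len b<len distinct (inj₂ (inj₂ (inj₂ eq))) = meet⇒rungEdge a<len b<len distinct second second eq

  rungEdge⇒shareEnd : ∀ {r s a b} → RungEdge r a s b → ShareEnd (edge r a) (edge s b)
  rungEdge⇒shareEnd {r} {s} (inj₁ (_ , inj₁ (refl , refl))) = inj₁ (trans (path-start r) (sym (path-start s)))
  rungEdge⇒shareEnd {r} {s} (inj₁ (_ , inj₂ (refl , refl))) = inj₂ (inj₂ (inj₂ (trans (path-end′ r) (sym (path-end′ s)))))
  rungEdge⇒shareEnd (inj₂ (refl , inj₁ refl)) = inj₂ (inj₁ refl)
  rungEdge⇒shareEnd (inj₂ (refl , inj₂ refl)) = inj₂ (inj₂ (inj₁ refl))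

  rungEdge⇒distinct : ∀ {r s a b} → RungEdge r a s b → ¬ ((r ≡ s) × (a ≡ b))
  rungEdge⇒distinct (inj₁ (r≢s , _)) (r≡s , _) = r≢s r≡s
  rungEdge⇒distinct (inj₂ (_ , inj₁ a≡1+a)) (_ , refl) = 1+n≢n (sym a≡1+a)
  rungEdge⇒distinct (inj₂ (_ , inj₂ a≡1+a)) (_ , refl) = 1+n≢n (sym a≡1+a)

  rung-bound : ∀ r (k : Fin (suc (rungLen r))) → toℕ k < len r
  rung-bound r k = subst (toℕ k <_) (sym (len≡1+rungLen r)) (toℕ<n k)

  rung : (r : Fin 3) → Fin (suc (rungLen r)) → Fin n
  rung r k = proj₁ (edgeOf-surjective _ _ (path-adj r (toℕ k) (rung-bound r k)))

  rung-edge : ∀ r k → SameEdge (edgeOf (rung r k)) (edge r (toℕ k))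
  rung-edge r k = proj₂ (edgeOf-surjective _ _ (path-adj r (toℕ k) (rung-bound r k)))

  rung-injective : ∀ r k s l → rung r k ≡ rung s l → (r ≡ s) × (toℕ k ≡ toℕ l)
  rung-injective r k s l eq = edge-injective (rung-bound r k) (rung-bound s l)
    (SameEdge-trans (SameEdge-sym (rung-edge r k)) (subst (λ i → SameEdge (edgeOf i) (edge s (toℕ l))) (sym eq) (rung-edge s l)))

  rung-adjacent⇔ : ∀ r k s l → Adj (FullRealization T) (rung r k) (rung s l) ⟺ PrismEdge rungLen r k s l
  rung-adjacent⇔ r k s l = adjacent⇒rungEdge , rungEdge⇒adjacent
    where
    adjacent⇒rungEdge : Adj (FullRealization T) (rung r k) (rung s l) → RungEdge r (toℕ k) s (toℕ l)
    adjacent⇒rungEdge adj@(rk≢sl , _) = shareEnd⇒rungEdge (rung-bound r k) (rung-bound s l) distinct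
      (ShareEnd-resp (rung-edge r k) (rung-edge s l) (proj₁ (adjacent⇔shareEnd _ _ rk≢sl) adj))
      where
      distinct : ¬ ((r ≡ s) × (toℕ k ≡ toℕ l))
      distinct (refl , k≡l) = rk≢sl (cong (rung r) (toℕ-injective k≡l))
    rungEdge⇒adjacent : RungEdge r (toℕ k) s (toℕ l) → Adj (FullRealization T) (rung r k) (rung s l)
    rungEdge⇒adjacent e = proj₂ (adjacent⇔shareEnd _ _ (rungEdge⇒distinct e ∘ rung-injective r k s l))
      (ShareEnd-resp (SameEdge-sym (rung-edge r k)) (SameEdge-sym (rung-edge s l)) (rungEdge⇒shareEnd e))

  oddPrism : HasOddPrism T
  oddPrism = rungLen , rung , (rung-injective , rung-adjacent⇔) , rungLen-odd

toℕ-mod : ∀ {L k} → k ≤ L → toℕ (k mod suc L) ≡ k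
toℕ-mod {L} {k} k≤L = trans (toℕ-fromℕ< _) (m≤n⇒m%n≡m k≤L)

-- The paths are extended from Fin (suc (len r)) to ℕ by reducing indices modulo suc (len r).
evenThetaSubgraph⇒EvenTheta : ∀ {m} {H : Graph m} → HasEvenThetaSubgraph H → EvenTheta H
evenThetaSubgraph⇒EvenTheta {H = H} (x , y , len , p , x≢y , p-start , p-end , p-adj , p-meet , len-even) = record
  { x = x ; y = y ; len = len ; path = path ; x≢y = x≢y
  ; path-start = λ r → trans (cong (p r) (toℕ-injective (toℕ-mod {len r} z≤n))) (p-start r)
  ; path-end = λ r → trans (cong (p r) (toℕ-injective (trans (toℕ-mod ≤-refl) (sym (toℕ-fromℕ (len r)))))) (p-end r)
  ; path-adj = path-adj
  ; path-meet = path-meet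
  ; len-even = len-even
  }
  where
  path : Fin 3 → ℕ → _
  path r k = p r (k mod suc (len r))

  path-adj : ∀ r k → k < len r → Adj H (path r k) (path r (suc k))
  path-adj r k k<len = subst₂ (Adj H) (cong (p r) (toℕ-injective k≡)) (cong (p r) (toℕ-injective 1+k≡)) (p-adj r i)
    where
    i = fromℕ< k<len
    k≡ : toℕ (inject₁ i) ≡ toℕ (k mod suc (len r))
    k≡ = trans (toℕ-inject₁ i) (trans (toℕ-fromℕ< k<len) (sym (toℕ-mod (<⇒≤ k<len))))
    1+k≡ : toℕ (Data.Fin.suc i) ≡ toℕ (suc k mod suc (len r))
    1+k≡ = trans (cong suc (toℕ-fromℕ< k<len)) (sym (toℕ-mod k<len))

  path-meet : ∀ r i s j → i ≤ len r → j ≤ len s → path r i ≡ path s j →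
              ((r ≡ s) × (i ≡ j)) ⊎ ((i ≡ 0) × (j ≡ 0)) ⊎ ((i ≡ len r) × (j ≡ len s))
  path-meet r i s j i≤len j≤len eq
    with p-meet r (i mod suc (len r)) s (j mod suc (len s)) eq
  ... | meet rewrite toℕ-mod i≤len | toℕ-mod j≤len = meet

module _ {A : Set} where

  Unique-++⁻ˡ : ∀ xs {ys : List A} → Unique (xs ++ ys) → Unique xs
  Unique-++⁻ˡ [] _ = []
  Unique-++⁻ˡ (x ∷ xs) (x∉ ∷ u) = ++⁻ˡ xs x∉ ∷ Unique-++⁻ˡ xs u

  Unique-++⁻ʳ : ∀ xs {ys : List A} → Unique (xs ++ ys) → Unique ys
  Unique-++⁻ʳ [] u = u
  Unique-++⁻ʳ (x ∷ xs) (_ ∷ u) = Unique-++⁻ʳ xs u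

  Unique-++⇒Disjoint : ∀ xs {ys : List A} → Unique (xs ++ ys) → Disjoint xs ys
  Unique-++⇒Disjoint (x ∷ xs) (x∉ ∷ _) (here refl , v∈ys) = All.lookup x∉ (∈-++⁺ʳ xs v∈ys) refl
  Unique-++⇒Disjoint (x ∷ xs) (_ ∷ u) (there v∈xs , v∈ys) = Unique-++⇒Disjoint xs u (v∈xs , v∈ys)

  Unique-reverse : ∀ {xs : List A} → Unique xs → Unique (reverse xs)
  Unique-reverse {[]} u = u
  Unique-reverse {x ∷ xs} (x∉ ∷ u) rewrite unfold-reverse x xs =
    ++⁺ (Unique-reverse u) (All.[] ∷ []) λ { (v∈ , here refl) → All.lookup x∉ (reverse⁻ v∈) refl }

fin3-pairwise : ∀ {ℓ} (R : Fin 3 → Fin 3 → Set ℓ) → (∀ {r s} → R r s → R s r) →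
                R 0F 1F → R 0F 2F → R 1F 2F → ∀ r s → r ≢ s → R r s
fin3-pairwise R sym₀ r01 r02 r12 = λ where
  0F 0F r≢s → ⊥-elim (r≢s refl)
  0F 1F _ → r01
  0F 2F _ → r02
  1F 0F _ → sym₀ r01
  1F 1F r≢s → ⊥-elim (r≢s refl)
  1F 2F _ → r12
  2F 0F _ → sym₀ r02
  2F 1F _ → sym₀ r12
  2F 2F r≢s → ⊥-elim (r≢s refl)

swap01 : Fin 3 → Fin 3
swap01 0F = 1F
swap01 1F = 0F
swap01 2F = 2F

swap01-involutive : ∀ r → swap01 (swap01 r) ≡ r
swap01-involutive 0F = refl
swap01-involutive 1F = refl
swap01-involutive 2F = refl

swap01-injective : ∀ {r s} → swap01 r ≡ swap01 s → r ≡ s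
swap01-injective {r} {s} eq = trans (sym (swap01-involutive r)) (trans (cong swap01 eq) (swap01-involutive s))

bool-pigeonhole : ∀ (a b c : Bool) → (a ≡ b) ⊎ (a ≡ c) ⊎ (b ≡ c)
bool-pigeonhole = λ where
  true  true  _     → inj₁ refl
  false false _     → inj₁ refl
  true  false true  → inj₂ (inj₁ refl)
  false true  false → inj₂ (inj₁ refl)
  true  false false → inj₂ (inj₂ refl)
  false true  true  → inj₂ (inj₂ refl)

module Walks {m} (H : Graph m) where
  open import Data.List.Membership.DecPropositional (_≟ᶠ_ {m}) using (_∈?_)

  private variable
    u v w z : Fin m
    L L₁ L₂ : List (Fin m)
    S : Pred (Fin m) _

  data Walk : Fin m → Fin m → List (Fin m) → Set where
    stay : Walk u u (u ∷ [])
    step : Adj H u w → Walk w v L → Walk u v (u ∷ L)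

  walk-snoc : Walk u v L → Adj H v w → Walk u w (L ++ w ∷ [])
  walk-snoc stay adj = step adj stay
  walk-snoc (step adj′ p) adj = step adj′ (walk-snoc p adj)

  walk-reverse : Walk u v L → Walk v u (reverse L)
  walk-reverse stay = stay
  walk-reverse (step {u} {L = L} adj p) rewrite unfold-reverse u L = walk-snoc (walk-reverse p) (symm H adj)

  walk-++ : Walk u v L → Adj H v w → Walk w z L₁ → Walk u z (L ++ L₁)
  walk-++ stay adj q = step adj q
  walk-++ (step adj′ p) adj q = step adj′ (walk-++ p adj q)

  walk-start∈ : Walk u v L → u ∈ L
  walk-start∈ stay = here refl
  walk-start∈ (step _ _) = here refl

  walk-split : Walk u v L → w ∈ L →
               ∃₂ λ L₁ L₂ → (L ≡ L₁ ++ w ∷ L₂) × Walk u w (L₁ ++ w ∷ []) × Walk w v (w ∷ L₂)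
  walk-split stay (here refl) = [] , [] , refl , stay , stay
  walk-split (step adj p) (here refl) = [] , _ , refl , stay , step adj p
  walk-split (step {u} adj p) (there w∈) with walk-split p w∈
  ... | L₁ , L₂ , refl , p₁ , p₂ = u ∷ L₁ , L₂ , refl , step adj p₁ , p₂

  record PathIn (S : Pred (Fin m) _) (u v : Fin m) : Set where
    field
      vertices : List (Fin m)
      walk     : Walk u v vertices
      unique   : Unique vertices
      inside   : (_∈ vertices) ⊆ S

  PathIn-suffix : (P : PathIn S w v) → u ∈ PathIn.vertices P → PathIn S u v
  PathIn-suffix P@record { walk = stay } (here refl) = P
  PathIn-suffix P@record { walk = step _ _ } (here refl) = P
  PathIn-suffix record { walk = step _ p ; unique = _ ∷ un ; inside = ins } (there u∈) =
    PathIn-suffix record { vertices = _ ; walk = p ; unique = un ; inside = ins ∘ there } u∈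

  connected⇒path : Connected H S u v → PathIn S u v
  connected⇒path (here Su) = record
    { vertices = _ ∷ [] ; walk = stay ; unique = All.[] ∷ [] ; inside = λ { (here refl) → Su } }
  connected⇒path {S} {u} (step Su adj c) with P ← connected⇒path c with u ∈? PathIn.vertices P
  ... | yes u∈P = PathIn-suffix P u∈P
  ... | no u∉P = record
    { vertices = u ∷ PathIn.vertices P ; walk = step adj (PathIn.walk P)
    ; unique = ¬Any⇒All¬ _ u∉P ∷ PathIn.unique P
    ; inside = λ { (here refl) → Su ; (there v∈) → PathIn.inside P v∈ } }

  record Tripod (S : Pred (Fin m) _) (t : Fin 3 → Fin m) : Set where
    field
      centre     : Fin m
      leg        : Fin 3 → List (Fin m)
      leg-walk   : ∀ k → Walk centre (t k) (leg k)
      leg-unique : ∀ k → Unique (leg k)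
      leg-inside : ∀ k → (_∈ leg k) ⊆ S
      legs-meet  : ∀ k l → k ≢ l → ∀ {v} → v ∈ leg k → v ∈ leg l → v ≡ centre

    centre-inside : S centre
    centre-inside = leg-inside 0F (walk-start∈ (leg-walk 0F))

  tripod-swap01 : ∀ {t} → Tripod S t → Tripod S (t ∘ swap01)
  tripod-swap01 T = record
    { centre = centre ; leg = leg ∘ swap01 ; leg-walk = leg-walk ∘ swap01
    ; leg-unique = leg-unique ∘ swap01 ; leg-inside = leg-inside ∘ swap01
    ; legs-meet = λ k l k≢l → legs-meet (swap01 k) (swap01 l) (k≢l ∘ swap01-injective) }
    where open Tripod T

  record FirstHit (P L : List (Fin m)) (q : Fin m) : Set where
    field
      hit           : Fin m
      prefix        : List (Fin m)
      prefix-walk   : Walk q hit prefix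
      prefix-unique : Unique prefix
      hit∈P         : hit ∈ P
      prefix∩P      : ∀ {v} → v ∈ prefix → v ∈ P → v ≡ hit
      prefix⊆       : (_∈ prefix) ⊆ (_∈ L)

  firstHit : ∀ {P t q} → t ∈ P → Walk q t L → Unique L → FirstHit P L q
  firstHit t∈P stay un = record
    { hit = _ ; prefix = _ ; prefix-walk = stay ; prefix-unique = un ; hit∈P = t∈P
    ; prefix∩P = λ { (here refl) _ → refl } ; prefix⊆ = λ v∈ → v∈ }
  firstHit {P = P} {q = q} t∈P (step adj p) (q∉ ∷ un) with q ∈? P
  ... | yes q∈P = record
    { hit = q ; prefix = q ∷ [] ; prefix-walk = stay ; prefix-unique = All.[] ∷ [] ; hit∈P = q∈P
    ; prefix∩P = λ { (here refl) _ → refl } ; prefix⊆ = λ { (here refl) → here refl } }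
  ... | no q∉P = record
    { hit = hit ; prefix = q ∷ prefix ; prefix-walk = step adj prefix-walk
    ; prefix-unique = ¬Any⇒All¬ prefix (λ q∈ → All.lookup q∉ (prefix⊆ q∈) refl) ∷ prefix-unique
    ; hit∈P = hit∈P
    ; prefix∩P = λ { (here refl) q∈P → ⊥-elim (q∉P q∈P) ; (there v∈) → prefix∩P v∈ }
    ; prefix⊆ = λ { (here refl) → here refl ; (there v∈) → there (prefix⊆ v∈) } }
    where open FirstHit (firstHit t∈P p un)

  -- A path Q from t 2F to t 0F first meets a path P from t 0F to t 1F at the centre.
  tripod : ∀ {t} → (∀ {u v} → S u → S v → Connected H S u v) → (∀ k → S (t k)) → Tripod S t
  tripod {S} {t} conn t∈S = record
    { centre = hit ; leg = leg ; leg-walk = leg-walk ; leg-unique = leg-unique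
    ; leg-inside = leg-inside
    ; legs-meet = fin3-pairwise _ (λ meet v∈l v∈k → meet v∈k v∈l) meet01 (meet-2 0F (λ ())) (meet-2 1F (λ ())) }
    where
    P = connected⇒path (conn (t∈S 0F) (t∈S 1F))
    Q = connected⇒path (conn (t∈S 2F) (t∈S 0F))
    open FirstHit (firstHit (walk-start∈ (PathIn.walk P)) (PathIn.walk Q) (PathIn.unique Q))
    split = walk-split (PathIn.walk P) hit∈P
    K M : List (Fin m)
    K = proj₁ split
    M = proj₁ (proj₂ split)
    P≡ : PathIn.vertices P ≡ K ++ hit ∷ M
    P≡ = proj₁ (proj₂ (proj₂ split))
    unique-KhM : Unique (K ++ hit ∷ M)
    unique-KhM = subst Unique P≡ (PathIn.unique P)
    on-P : (_∈ K ++ hit ∷ M) ⊆ (_∈ PathIn.vertices P)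
    on-P v∈ = subst (_ ∈_) (sym P≡) v∈

    leg : Fin 3 → List (Fin m)
    leg 0F = reverse (K ++ hit ∷ [])
    leg 1F = hit ∷ M
    leg 2F = reverse prefix

    leg-walk : ∀ k → Walk hit (t k) (leg k)
    leg-walk 0F = walk-reverse (proj₁ (proj₂ (proj₂ (proj₂ split))))
    leg-walk 1F = proj₂ (proj₂ (proj₂ (proj₂ split)))
    leg-walk 2F = walk-reverse prefix-walk

    leg-unique : ∀ k → Unique (leg k)
    leg-unique 0F = Unique-reverse (Unique-++⁻ˡ (K ++ hit ∷ []) (subst Unique (sym (++-assoc K (hit ∷ []) M)) unique-KhM))
    leg-unique 1F = Unique-++⁻ʳ K unique-KhM
    leg-unique 2F = Unique-reverse prefix-unique

    legs01-on-P : ∀ {k v} → k ≢ 2F → v ∈ leg k → v ∈ K ++ hit ∷ M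
    legs01-on-P {0F} _ v∈ with ∈-++⁻ K (reverse⁻ v∈)
    ... | inj₁ v∈K = ∈-++⁺ˡ v∈K
    ... | inj₂ (here refl) = ∈-++⁺ʳ K (here refl)
    legs01-on-P {1F} _ v∈ = ∈-++⁺ʳ K v∈
    legs01-on-P {2F} k≢2 _ = ⊥-elim (k≢2 refl)

    leg-inside : ∀ k → (_∈ leg k) ⊆ S
    leg-inside 0F v∈ = PathIn.inside P (on-P (legs01-on-P {0F} (λ ()) v∈))
    leg-inside 1F v∈ = PathIn.inside P (on-P (legs01-on-P {1F} (λ ()) v∈))
    leg-inside 2F v∈ = PathIn.inside Q (prefix⊆ (reverse⁻ v∈))

    meet01 : ∀ {v} → v ∈ leg 0F → v ∈ leg 1F → v ≡ hit
    meet01 v∈0 v∈1 with ∈-++⁻ K (reverse⁻ v∈0)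
    ... | inj₁ v∈K = ⊥-elim (Unique-++⇒Disjoint K unique-KhM (v∈K , v∈1))
    ... | inj₂ (here refl) = refl

    meet-2 : ∀ k → k ≢ 2F → ∀ {v} → v ∈ leg k → v ∈ leg 2F → v ≡ hit
    meet-2 k k≢2 v∈k v∈2 = prefix∩P (reverse⁻ v∈2) (on-P (legs01-on-P k≢2 v∈k))

  record PathTheta (x y : Fin m) : Set where
    field
      arm        : Fin 3 → List (Fin m)
      arm-walk   : ∀ r → Walk x y (arm r)
      arm-unique : ∀ r → Unique (arm r)
      arms-meet  : ∀ r s → r ≢ s → ∀ {v} → v ∈ arm r → v ∈ arm s → (v ≡ x) ⊎ (v ≡ y)

  module ThetaThroughTripods {A B C D : Pred (Fin m) _}
    (A⊥B : A ⊥ B) (A⊥C : A ⊥ C) (A⊥D : A ⊥ D) (B⊥C : B ⊥ C) (B⊥D : B ⊥ D) (C⊥D : C ⊥ D)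
    {ta tb : Fin 3 → Fin m} (TA : Tripod A ta) (TB : Tripod B tb)
    {u₁ v₁ u₂ v₂ : Fin m} (PC : PathIn C u₁ v₁) (PD : PathIn D u₂ v₂)
    (e₀ : Adj H (ta 0F) (tb 0F))
    (e₁ : Adj H (ta 1F) u₁) (e₁′ : Adj H v₁ (tb 1F))
    (e₂ : Adj H (ta 2F) u₂) (e₂′ : Adj H v₂ (tb 2F)) where

    module TA = Tripod TA
    module TB = Tripod TB

    middle : Fin 3 → List (Fin m)
    middle 0F = []
    middle 1F = PathIn.vertices PC
    middle 2F = PathIn.vertices PD

    Middle : Fin 3 → Pred (Fin m) _
    Middle 0F = ∅
    Middle 1F = C
    Middle 2F = D

    middle-inside : ∀ r → (_∈ middle r) ⊆ Middle r
    middle-inside 0F ()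
    middle-inside 1F = PathIn.inside PC
    middle-inside 2F = PathIn.inside PD

    middle-unique : ∀ r → Unique (middle r)
    middle-unique 0F = []
    middle-unique 1F = PathIn.unique PC
    middle-unique 2F = PathIn.unique PD

    A⊥Middle : ∀ r → A ⊥ Middle r
    A⊥Middle 0F (_ , ())
    A⊥Middle 1F = A⊥C
    A⊥Middle 2F = A⊥D

    B⊥Middle : ∀ r → B ⊥ Middle r
    B⊥Middle 0F (_ , ())
    B⊥Middle 1F = B⊥C
    B⊥Middle 2F = B⊥D

    Middle-disjoint : ∀ r s → r ≢ s → Middle r ⊥ Middle s
    Middle-disjoint 0F _ _ (() , _)
    Middle-disjoint _ 0F _ (_ , ())
    Middle-disjoint 1F 1F r≢s = ⊥-elim (r≢s refl)
    Middle-disjoint 1F 2F _ = C⊥D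
    Middle-disjoint 2F 1F _ (d , c) = C⊥D (c , d)
    Middle-disjoint 2F 2F r≢s = ⊥-elim (r≢s refl)

    arm : Fin 3 → List (Fin m)
    arm r = TA.leg r ++ (middle r ++ reverse (TB.leg r))

    arm-walk : ∀ r → Walk TA.centre TB.centre (arm r)
    arm-walk 0F = walk-++ (TA.leg-walk 0F) e₀ (walk-reverse (TB.leg-walk 0F))
    arm-walk 1F = walk-++ (TA.leg-walk 1F) e₁ (walk-++ (PathIn.walk PC) e₁′ (walk-reverse (TB.leg-walk 1F)))
    arm-walk 2F = walk-++ (TA.leg-walk 2F) e₂ (walk-++ (PathIn.walk PD) e₂′ (walk-reverse (TB.leg-walk 2F)))

    data Position (r : Fin 3) (v : Fin m) : Set where
      onA      : v ∈ TA.leg r → Position r v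
      onMiddle : v ∈ middle r → Position r v
      onB      : v ∈ TB.leg r → Position r v

    position : ∀ r {v} → v ∈ arm r → Position r v
    position r v∈ with ∈-++⁻ (TA.leg r) v∈
    ... | inj₁ v∈A = onA v∈A
    ... | inj₂ v∈rest with ∈-++⁻ (middle r) v∈rest
    ...   | inj₁ v∈M = onMiddle v∈M
    ...   | inj₂ v∈B = onB (reverse⁻ v∈B)

    arm-unique : ∀ r → Unique (arm r)
    arm-unique r = ++⁺ (TA.leg-unique r) (++⁺ (middle-unique r) (Unique-reverse (TB.leg-unique r)) middle∩B) A∩rest
      where
      middle∩B : Disjoint (middle r) (reverse (TB.leg r))
      middle∩B (v∈M , v∈B) = B⊥Middle r (TB.leg-inside r (reverse⁻ v∈B) , middle-inside r v∈M)
      A∩rest : Disjoint (TA.leg r) (middle r ++ reverse (TB.leg r))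
      A∩rest (v∈A , v∈rest) with ∈-++⁻ (middle r) v∈rest
      ... | inj₁ v∈M = A⊥Middle r (TA.leg-inside r v∈A , middle-inside r v∈M)
      ... | inj₂ v∈B = A⊥B (TA.leg-inside r v∈A , TB.leg-inside r (reverse⁻ v∈B))

    arms-meet : ∀ r s → r ≢ s → ∀ {v} → v ∈ arm r → v ∈ arm s → (v ≡ TA.centre) ⊎ (v ≡ TB.centre)
    arms-meet r s r≢s v∈r v∈s with position r v∈r | position s v∈s
    ... | onA p | onA q = inj₁ (TA.legs-meet r s r≢s p q)
    ... | onB p | onB q = inj₂ (TB.legs-meet r s r≢s p q)
    ... | onA p | onB q = ⊥-elim (A⊥B (TA.leg-inside r p , TB.leg-inside s q))
    ... | onB p | onA q = ⊥-elim (A⊥B (TA.leg-inside s q , TB.leg-inside r p))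
    ... | onA p | onMiddle q = ⊥-elim (A⊥Middle s (TA.leg-inside r p , middle-inside s q))
    ... | onMiddle p | onA q = ⊥-elim (A⊥Middle r (TA.leg-inside s q , middle-inside r p))
    ... | onB p | onMiddle q = ⊥-elim (B⊥Middle s (TB.leg-inside r p , middle-inside s q))
    ... | onMiddle p | onB q = ⊥-elim (B⊥Middle r (TB.leg-inside s q , middle-inside r p))
    ... | onMiddle p | onMiddle q = ⊥-elim (Middle-disjoint r s r≢s (middle-inside r p , middle-inside s q))

    theta : PathTheta TA.centre TB.centre
    theta = record { arm = arm ; arm-walk = arm-walk ; arm-unique = arm-unique ; arms-meet = arms-meet }

    centres-distinct : TA.centre ≢ TB.centre
    centres-distinct eq = A⊥B (TA.centre-inside , subst B (sym eq) TB.centre-inside)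

  module K4Model (β : Fin m → Maybe (Fin 4))
    (branch-connected : ∀ i u v → β u ≡ just i → β v ≡ just i → Connected H (λ w → β w ≡ just i) u v)
    (link : ∀ i j → i ≢ j → ∃ λ u → ∃ λ v → (β u ≡ just i) × (β v ≡ just j) × Adj H u v) where

    branch : Fin 4 → Pred (Fin m) _
    branch i v = β v ≡ just i

    branch-disjoint : ∀ i j → i ≢ j → branch i ⊥ branch j
    branch-disjoint i j i≢j (βv≡i , βv≡j) = i≢j (just-injective (trans (sym βv≡i) βv≡j))

    near far : ∀ i j → i ≢ j → Fin m
    near i j i≢j = proj₁ (link i j i≢j)
    far i j i≢j = proj₁ (proj₂ (link i j i≢j))

    near-inside : ∀ i j i≢j → branch i (near i j i≢j)
    near-inside i j i≢j = proj₁ (proj₂ (proj₂ (link i j i≢j)))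

    far-inside : ∀ i j i≢j → branch j (far i j i≢j)
    far-inside i j i≢j = proj₁ (proj₂ (proj₂ (proj₂ (link i j i≢j))))

    near-far : ∀ i j i≢j → Adj H (near i j i≢j) (far i j i≢j)
    near-far i j i≢j = proj₂ (proj₂ (proj₂ (proj₂ (link i j i≢j))))

    attachment : Fin 3 → Fin 3 → Fin m
    attachment 0F 0F = near 0F 1F λ ()
    attachment 0F 1F = near 0F 2F λ ()
    attachment 0F 2F = near 0F 3F λ ()
    attachment 1F 0F = far 0F 1F λ ()
    attachment 1F 1F = near 1F 2F λ ()
    attachment 1F 2F = near 1F 3F λ ()
    attachment 2F 0F = far 0F 2F λ ()
    attachment 2F 1F = far 1F 2F λ ()
    attachment 2F 2F = near 2F 3F λ ()

    attachment-inside : ∀ i k → branch (inject₁ i) (attachment i k)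
    attachment-inside 0F 0F = near-inside 0F 1F λ ()
    attachment-inside 0F 1F = near-inside 0F 2F λ ()
    attachment-inside 0F 2F = near-inside 0F 3F λ ()
    attachment-inside 1F 0F = far-inside 0F 1F λ ()
    attachment-inside 1F 1F = near-inside 1F 2F λ ()
    attachment-inside 1F 2F = near-inside 1F 3F λ ()
    attachment-inside 2F 0F = far-inside 0F 2F λ ()
    attachment-inside 2F 1F = far-inside 1F 2F λ ()
    attachment-inside 2F 2F = near-inside 2F 3F λ ()

    T : ∀ i → Tripod (branch (inject₁ i)) (attachment i)
    T i = tripod (branch-connected _ _ _) (attachment-inside i)

    centre : Fin 3 → Fin m
    centre i = Tripod.centre (T i)

    path : ∀ i {u v} → branch i u → branch i v → PathIn (branch i) u v
    path i bu bv = connected⇒path (branch-connected i _ _ bu bv)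

    theta01 : (centre 0F ≢ centre 1F) × PathTheta (centre 0F) (centre 1F)
    theta01 = centres-distinct , theta
      where
      open ThetaThroughTripods
        (branch-disjoint 0F 1F λ ()) (branch-disjoint 0F 2F λ ()) (branch-disjoint 0F 3F λ ())
        (branch-disjoint 1F 2F λ ()) (branch-disjoint 1F 3F λ ()) (branch-disjoint 2F 3F λ ())
        (T 0F) (T 1F)
        (path 2F (far-inside 0F 2F λ ()) (far-inside 1F 2F λ ()))
        (path 3F (far-inside 0F 3F λ ()) (far-inside 1F 3F λ ()))
        (near-far 0F 1F λ ())
        (near-far 0F 2F λ ()) (symm H (near-far 1F 2F λ ()))
        (near-far 0F 3F λ ()) (symm H (near-far 1F 3F λ ()))

    theta02 : (centre 0F ≢ centre 2F) × PathTheta (centre 0F) (centre 2F)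
    theta02 = centres-distinct , theta
      where
      open ThetaThroughTripods
        (branch-disjoint 0F 2F λ ()) (branch-disjoint 0F 1F λ ()) (branch-disjoint 0F 3F λ ())
        (branch-disjoint 2F 1F λ ()) (branch-disjoint 2F 3F λ ()) (branch-disjoint 1F 3F λ ())
        (tripod-swap01 (T 0F)) (T 2F)
        (path 1F (far-inside 0F 1F λ ()) (near-inside 1F 2F λ ()))
        (path 3F (far-inside 0F 3F λ ()) (far-inside 2F 3F λ ()))
        (near-far 0F 2F λ ())
        (near-far 0F 1F λ ()) (near-far 1F 2F λ ())
        (near-far 0F 3F λ ()) (symm H (near-far 2F 3F λ ()))

    theta12 : (centre 1F ≢ centre 2F) × PathTheta (centre 1F) (centre 2F)
    theta12 = centres-distinct , theta
      where
      open ThetaThroughTripods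
        (branch-disjoint 1F 2F λ ()) (branch-disjoint 1F 0F λ ()) (branch-disjoint 1F 3F λ ())
        (branch-disjoint 2F 0F λ ()) (branch-disjoint 2F 3F λ ()) (branch-disjoint 0F 3F λ ())
        (tripod-swap01 (T 1F)) (tripod-swap01 (T 2F))
        (path 0F (near-inside 0F 1F λ ()) (near-inside 0F 2F λ ()))
        (path 3F (far-inside 1F 3F λ ()) (far-inside 2F 3F λ ()))
        (near-far 1F 2F λ ())
        (symm H (near-far 0F 1F λ ())) (near-far 0F 2F λ ())
        (near-far 1F 3F λ ()) (symm H (near-far 2F 3F λ ()))

    sameColourTheta : (c : Fin m → Bool) → ∃₂ λ x y → (x ≢ y) × (c x ≡ c y) × PathTheta x y
    sameColourTheta c with bool-pigeonhole (c (centre 0F)) (c (centre 1F)) (c (centre 2F))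
    ... | inj₁ c₀≡c₁ = _ , _ , proj₁ theta01 , c₀≡c₁ , proj₂ theta01
    ... | inj₂ (inj₁ c₀≡c₂) = _ , _ , proj₁ theta02 , c₀≡c₂ , proj₂ theta02
    ... | inj₂ (inj₂ c₁≡c₂) = _ , _ , proj₁ theta12 , c₁≡c₂ , proj₂ theta12

  k4Minor⇒sameColourTheta : (c : Fin m → Bool) → HasK4Minor H →
                             ∃₂ λ x y → (x ≢ y) × (c x ≡ c y) × PathTheta x y
  k4Minor⇒sameColourTheta c (β , _ , branch-connected , link) = K4Model.sameColourTheta β branch-connected link c

  walk-length : Walk u v L → length L ≡ suc (pred (length L))
  walk-length stay = refl
  walk-length (step _ _) = refl

  nth : Fin m → List (Fin m) → ℕ → Fin m
  nth d [] _ = d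
  nth d (a ∷ L) zero = a
  nth d (a ∷ L) (suc k) = nth d L k

  nth-start : ∀ {d} → Walk u v L → nth d L 0 ≡ u
  nth-start stay = refl
  nth-start (step _ _) = refl

  nth-end : ∀ {d} → Walk u v L → nth d L (pred (length L)) ≡ v
  nth-end stay = refl
  nth-end (step _ p) rewrite walk-length p = nth-end p

  nth-adj : ∀ {d} → Walk u v L → ∀ k → k < pred (length L) → Adj H (nth d L k) (nth d L (suc k))
  nth-adj (step adj p) zero _ = subst (Adj H _) (sym (nth-start p)) adj
  nth-adj (step adj p) (suc k) 1+k< = nth-adj p k (≤-pred (subst (suc (suc k) ≤_) (walk-length p) 1+k<))

  nth-∈ : ∀ {d} L k → k < length L → nth d L k ∈ L
  nth-∈ (a ∷ L) zero _ = here refl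
  nth-∈ (a ∷ L) (suc k) (s≤s k<) = there (nth-∈ L k k<)

  nth-injective : ∀ {d} L → Unique L → ∀ i j → i < length L → j < length L → nth d L i ≡ nth d L j → i ≡ j
  nth-injective (a ∷ L) _ zero zero _ _ _ = refl
  nth-injective (a ∷ L) (a∉ ∷ _) zero (suc j) _ (s≤s j<) eq = ⊥-elim (All.lookup a∉ (nth-∈ L j j<) eq)
  nth-injective (a ∷ L) (a∉ ∷ _) (suc i) zero (s≤s i<) _ eq = ⊥-elim (All.lookup a∉ (nth-∈ L i i<) (sym eq))
  nth-injective (a ∷ L) (_ ∷ u) (suc i) (suc j) (s≤s i<) (s≤s j<) eq = cong suc (nth-injective L u i j i< j< eq)

  module Bipartite (c : Fin m → Bool) (proper : ∀ u v → Adj H u v → c u ≢ c v) where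

    adj⇒colour-flip : Adj H u w → c w ≡ not (c u)
    adj⇒colour-flip {u} {w} adj with c u in cu | c w in cw
    ... | true  | false = refl
    ... | false | true  = refl
    ... | true  | true  = ⊥-elim (proper _ _ adj (trans cu (sym cw)))
    ... | false | false = ⊥-elim (proper _ _ adj (trans cu (sym cw)))

    walk-colour : Walk u v L → c v ≡ iterate not (c u) (pred (length L))
    walk-colour stay = refl
    walk-colour (step {L = L} adj p) rewrite walk-length p =
      trans (walk-colour p) (cong (λ b → iterate not b (pred (length L))) (adj⇒colour-flip adj))

    pathTheta⇒EvenTheta : ∀ {x y} → x ≢ y → c x ≡ c y → PathTheta x y → EvenTheta H
    pathTheta⇒EvenTheta {x} {y} x≢y cx≡cy Θ = record
      { x = x ; y = y ; len = len ; path = path ; x≢y = x≢y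
      ; path-start = λ r → nth-start (arm-walk r)
      ; path-end = λ r → nth-end (arm-walk r)
      ; path-adj = λ r → nth-adj (arm-walk r)
      ; path-meet = path-meet
      ; len-even = λ r → iterate-not-even (c x) (len r) (sym (trans cx≡cy (walk-colour (arm-walk r))))
      }
      where
      open PathTheta Θ
      len : Fin 3 → ℕ
      len r = pred (length (arm r))
      path : Fin 3 → ℕ → Fin m
      path r = nth x (arm r)
      bound : ∀ r {i} → i ≤ len r → i < length (arm r)
      bound r i≤ = subst (suc _ ≤_) (sym (walk-length (arm-walk r))) (s≤s i≤)
      index-injective : ∀ r {i j} → i ≤ len r → j ≤ len r → path r i ≡ path r j → i ≡ j
      index-injective r {i} {j} i≤ j≤ = nth-injective (arm r) (arm-unique r) i j (bound r i≤) (bound r j≤)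
      path-meet : ∀ r i s j → i ≤ len r → j ≤ len s → path r i ≡ path s j →
                  ((r ≡ s) × (i ≡ j)) ⊎ ((i ≡ 0) × (j ≡ 0)) ⊎ ((i ≡ len r) × (j ≡ len s))
      path-meet r i s j i≤ j≤ eq with r ≟ᶠ s
      ... | yes refl = inj₁ (refl , index-injective r i≤ j≤ eq)
      ... | no r≢s with arms-meet r s r≢s (nth-∈ (arm r) i (bound r i≤)) (subst (_∈ arm s) (sym eq) (nth-∈ (arm s) j (bound s j≤)))
      ...   | inj₁ v≡x = inj₂ (inj₁ (index-injective r i≤ z≤n (trans v≡x (sym (nth-start (arm-walk r))))
                                   , index-injective s j≤ z≤n (trans (trans (sym eq) v≡x) (sym (nth-start (arm-walk s))))))
      ...   | inj₂ v≡y = inj₂ (inj₂ (index-injective r i≤ ≤-refl (trans v≡y (sym (nth-end (arm-walk r))))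
                                   , index-injective s j≤ ≤-refl (trans (trans (sym eq) v≡y) (sym (nth-end (arm-walk s))))))

proposition4p4 : ∀ (n : ℕ) (T : Trigraph n) → IsLineTrigraph T → ¬ HasOddPrism T →
    ∀ (m : ℕ) (H : Graph m) → Bipartite H → IsLineGraphOf (FullRealization T) H →
    ¬ HasEvenThetaSubgraph H × SeriesParallel H
proposition4p4 n T _ no-odd-prism m H (c , proper) L = no-even-theta , no-K4-minor
  where
  open Walks H
  open Bipartite c proper

  odd-prism : EvenTheta H → HasOddPrism T
  odd-prism = OddPrismOfEvenTheta.oddPrism {T = T} L

  no-even-theta : ¬ HasEvenThetaSubgraph H
  no-even-theta = no-odd-prism ∘ odd-prism ∘ evenThetaSubgraph⇒EvenTheta

  no-K4-minor : ¬ HasK4Minor H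
  no-K4-minor k4 with _ , _ , x≢y , cx≡cy , Θ ← k4Minor⇒sameColourTheta c k4 =
    no-odd-prism (odd-prism (pathTheta⇒EvenTheta x≢y cx≡cy Θ))
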